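{- Let $n>m>0$ and $x=x_1\ldots x_{n+m-1}$. (a) If $ED(x_m,\ldots,x_n)=0$ then $ED_n^{\boxplus m}(x_1,\ldots,x_{n+m-1})=0^m$. (b) If $ED(x_m,\ldots,x_n)=1$, define $i_L=\max\{j\in[m-1]: ED(x_j,\ldots,x_n)=0\}$ (with $i_L=0$ if this set is empty) and $i_R=\min\{j\in[m-1]: ED(x_m,\ldots,x_{n+j})=0\}$ (with $i_R=m$ if this set is empty). Then \[ED_n^{\boxplus m}(x_1,\ldots,x_{n+m-1})=0^{i_L}1^{m-i_L}\ \land\ 1^{i_R}0^{m-i_R}\ \land\ ED_{m-1}^{\boxplus m}(x_1,\ldots,x_{m-1},x_{n+1},\ldots,x_{n+m-1}),\] where $\land$ denotes bitwise conjunction of length-$m$ bit strings.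
   Context: $ED(a)=1$ if all symbols of the string $a$ are distinct and $0$ otherwise; $ED_n$ is $ED$ restricted to strings of length $n$. For $f:D^n\to R$, $f^{\boxplus t}:D^{n+t-1}\to R^t$ is $f^{\boxplus t}(x)=(f(x_i\ldots x_{i+n-1}))_{i=1}^t$. Thus $ED_n^{\boxplus m}$ takes a string of length $n+m-1$ and $ED_{m-1}^{\boxplus m}$ takes a string of length $2m-2$. -}

module Defs where

open import Level using (Level)
open import Data.Bool using (Bool; true; false; not)
open import Data.Nat using (ℕ; suc; _+_; _∸_; _⊔_; _⊓_)
open import Data.List using (List; take; drop; map; upTo; filter; foldr)
open import Data.List.Relation.Unary.Unique.DecPropositional using (unique?)
open import Relation.Binary.Definitions using (DecidableEquality)
open import Relation.Nullary.Decidable using (⌊_⌋)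
open import Relation.Binary.PropositionalEquality using (_≡_)
open import Data.Bool.Properties using () renaming (_≟_ to _≟B_)

private variable
  a : Level

ED : {A : Set a} → DecidableEquality A → List A → Bool
ED _≟_ s = ⌊ unique? _≟_ s ⌋

-- f^{⊞t} applied with window length n: (f(x_{i..i+n-1}))_{i=1..t}
-- (0-indexed: window i starts at position i, i = 0 .. t-1)
slide : {A : Set a} → (List A → Bool) → ℕ → ℕ → List A → List Bool
slide f n t x = map (λ i → f (take n (drop i x))) (upTo t)

-- 1-indexed inclusive substring x_i ... x_j
sub : {A : Set a} → ℕ → ℕ → List A → List A
sub i j x = take (j + 1 ∸ i) (drop (i ∸ 1) x)

range1 : ℕ → List ℕ
range1 k = map suc (upTo k)

iL : {A : Set a} → DecidableEquality A → ℕ → ℕ → List A → ℕ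
iL _≟_ n m x =
  foldr _⊔_ 0 (filter (λ j → ED _≟_ (sub j n x) ≟B false) (range1 (m ∸ 1)))

iR : {A : Set a} → DecidableEquality A → ℕ → ℕ → List A → ℕ
iR _≟_ n m x =
  foldr _⊓_ m (filter (λ j → ED _≟_ (sub m (n + j) x) ≟B false) (range1 (m ∸ 1)))

-- Split x = P ++ M ++ Q with |P| = |Q| = m − 1 and M = x_m … x_n.  The i-th
-- window (0 ≤ i < m) is drop i P ++ M ++ take i Q, and a list of the form
-- X ++ Y ++ Z is repetition-free iff X ++ Y, Y ++ Z and X ++ Z are.  Here
-- X ++ Z is the i-th window of P ++ Q, while X ++ Y and Y ++ Z are suffix-
-- and prefix-monotone in i, so once M itself is repetition-free they switch
-- exactly at the thresholds i_L and i_R.  If M repeats a symbol, every window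
-- does.
module Submission where

open import Defs
open import Level using (Level)
open import Data.Bool using (Bool; true; false; _∧_; not)
open import Data.Bool.Properties using () renaming (_≟_ to _≟B_)
open import Data.Nat using (ℕ; zero; suc; _+_; _∸_; _<_; _≤_; _<ᵇ_; _⊔_; _⊓_; z≤n; s≤s; z<s)
open import Data.Nat.Properties
open import Data.List using (List; []; _∷_; length; take; drop; replicate; zipWith; _++_; applyUpTo; filter; foldr)
open import Data.List.Properties using (map-upTo; drop-drop; take-take; take++drop≡id; length-take; length-drop; drop-all; ++-assoc; ++-identityʳ)
open import Data.List.Membership.Propositional using (_∈_)
open import Data.List.Membership.Propositional.Properties using (∈-filter⁺; ∈-filter⁻; ∈-map⁺; ∈-map⁻; ∈-upTo⁺; ∈-upTo⁻; foldr-selective)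
open import Data.List.Relation.Unary.Any using (here; there)
open import Data.List.Relation.Unary.All as All using (All; []; _∷_)
import Data.List.Relation.Unary.All.Properties as All
open import Data.List.Relation.Unary.AllPairs using (AllPairs; []; _∷_)
import Data.List.Relation.Unary.AllPairs.Properties as AllPairs
open import Data.List.Relation.Unary.Unique.Propositional using (Unique)
open import Data.List.Relation.Unary.Unique.DecPropositional using (unique?)
open import Data.Product using (_×_; _,_; proj₁; proj₂; ∃; ∃₂; uncurry)
open import Data.Sum using (inj₁; inj₂)
open import Function using (_∘_; id)
open import Function.Bundles using (_⇔_; mk⇔; Equivalence)
open import Relation.Binary.Core using (Rel)
open import Relation.Binary.Definitions using (DecidableEquality)
open import Relation.Binary.PropositionalEquality using (_≡_; refl; sym; trans; cong; cong₂; subst; module ≡-Reasoning)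
open import Relation.Nullary using (¬_; yes; no; contradiction)
open import Relation.Nullary.Decidable using (decidable-stable)
open import Relation.Nullary.Reflects using (Reflects; ofʸ; ofⁿ; invert; det; ¬-reflects; _×-reflects_)
open import Relation.Unary using (Pred; Decidable)

open Equivalence using (to; from)
open ≡-Reasoning

private variable
  a ℓ : Level
  A B : Set a
  b : Bool
  i j k m : ℕ

Reflects-resp-⇔ : A ⇔ B → Reflects A b → Reflects B b
Reflects-resp-⇔ A⇔B (ofʸ x) = ofʸ (to A⇔B x)
Reflects-resp-⇔ A⇔B (ofⁿ ¬x) = ofⁿ (¬x ∘ from A⇔B)

take-length-++ : ∀ (xs : List A) ys → take (length xs) (xs ++ ys) ≡ xs
take-length-++ []       ys = refl
take-length-++ (x ∷ xs) ys = cong (x ∷_) (take-length-++ xs ys)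

take-length+-++ : ∀ (xs : List A) n ys → take (length xs + n) (xs ++ ys) ≡ xs ++ take n ys
take-length+-++ []       n ys = refl
take-length+-++ (x ∷ xs) n ys = cong (x ∷_) (take-length+-++ xs n ys)

drop-length-++ : ∀ (xs : List A) ys → drop (length xs) (xs ++ ys) ≡ ys
drop-length-++ []       ys = refl
drop-length-++ (x ∷ xs) ys = drop-length-++ xs ys

take-drop-++ : ∀ (xs : List A) n ys → i ≤ length xs →
               take (length xs ∸ i + n) (drop i (xs ++ ys)) ≡ drop i xs ++ take n ys
take-drop-++ {i = zero}  xs       n ys _         = take-length+-++ xs n ys
take-drop-++ {i = suc i} (x ∷ xs) n ys (s≤s i≤∣xs∣) = take-drop-++ xs n ys i≤∣xs∣

take++drop-take : ∀ (xs : List A) → i ≤ j → take i xs ++ drop i (take j xs) ≡ take j xs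
take++drop-take {i = i} {j} xs i≤j = begin
  take i xs ++ drop i (take j xs)           ≡⟨ cong (λ t → take t xs ++ drop i (take j xs)) (sym (m≤n⇒m⊓n≡m i≤j)) ⟩
  take (i ⊓ j) xs ++ drop i (take j xs)     ≡⟨ cong (_++ drop i (take j xs)) (sym (take-take i j xs)) ⟩
  take i (take j xs) ++ drop i (take j xs)  ≡⟨ take++drop≡id i (take j xs) ⟩
  take j xs                                 ∎

take-drop++drop : ∀ (xs : List A) → i ≤ j → take (j ∸ i) (drop i xs) ++ drop j xs ≡ drop i xs
take-drop++drop {i = i} {j} xs i≤j = begin
  take (j ∸ i) (drop i xs) ++ drop j xs                ≡⟨ cong (λ t → take (j ∸ i) (drop i xs) ++ drop t xs) (sym (m+[n∸m]≡n i≤j)) ⟩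
  take (j ∸ i) (drop i xs) ++ drop (i + (j ∸ i)) xs    ≡⟨ cong (take (j ∸ i) (drop i xs) ++_) (sym (drop-drop i (j ∸ i) xs)) ⟩
  take (j ∸ i) (drop i xs) ++ drop (j ∸ i) (drop i xs) ≡⟨ take++drop≡id (j ∸ i) (drop i xs) ⟩
  drop i xs                                            ∎

three-way-split : ∀ (xs : List A) → i ≤ j → j ≤ length xs →
                  ∃₂ λ ys zs → ∃ λ ws → length ys ≡ i × length ys + length zs ≡ j × ys ++ zs ++ ws ≡ xs
three-way-split {i = i} {j} xs i≤j j≤∣xs∣ =
  take i xs , take (j ∸ i) (drop i xs) , drop j xs , ∣take∣ , ∣take∣+∣take-drop∣ , split
  where
  ∣take∣ : length (take i xs) ≡ i
  ∣take∣ = trans (length-take i xs) (m≤n⇒m⊓n≡m (≤-trans i≤j j≤∣xs∣))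
  ∣take-drop∣ : length (take (j ∸ i) (drop i xs)) ≡ j ∸ i
  ∣take-drop∣ = trans (length-take (j ∸ i) (drop i xs))
    (m≤n⇒m⊓n≡m (subst (j ∸ i ≤_) (sym (length-drop i xs)) (∸-monoˡ-≤ i j≤∣xs∣)))
  ∣take∣+∣take-drop∣ : length (take i xs) + length (take (j ∸ i) (drop i xs)) ≡ j
  ∣take∣+∣take-drop∣ = trans (cong₂ _+_ ∣take∣ ∣take-drop∣) (m+[n∸m]≡n i≤j)
  split : take i xs ++ take (j ∸ i) (drop i xs) ++ drop j xs ≡ xs
  split = trans (cong (take i xs ++_) (take-drop++drop xs i≤j)) (take++drop≡id i xs)

applyUpTo-cong : ∀ {f g : ℕ → A} n → (∀ {i} → i < n → f i ≡ g i) → applyUpTo f n ≡ applyUpTo g n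
applyUpTo-cong zero    f≡g = refl
applyUpTo-cong (suc n) f≡g = cong₂ _∷_ (f≡g z<s) (applyUpTo-cong n (f≡g ∘ s≤s))

zipWith-applyUpTo : ∀ (_•_ : A → A → A) f g n →
                    zipWith _•_ (applyUpTo f n) (applyUpTo g n) ≡ applyUpTo (λ i → f i • g i) n
zipWith-applyUpTo _•_ f g zero    = refl
zipWith-applyUpTo _•_ f g (suc n) = cong (_ ∷_) (zipWith-applyUpTo _•_ (f ∘ suc) (g ∘ suc) n)

applyUpTo-const : ∀ (x : A) n → applyUpTo (λ _ → x) n ≡ replicate n x
applyUpTo-const x zero    = refl
applyUpTo-const x (suc n) = cong (x ∷_) (applyUpTo-const x n)

applyUpTo-<ᵇ : ∀ (f : Bool → A) → k ≤ m →
               applyUpTo (λ i → f (i <ᵇ k)) m ≡ replicate k (f true) ++ replicate (m ∸ k) (f false)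
applyUpTo-<ᵇ {m = m} f z≤n     = applyUpTo-const (f false) m
applyUpTo-<ᵇ         f (s≤s k≤n) = cong (f true ∷_) (applyUpTo-<ᵇ f k≤n)

module _ {R : Rel A ℓ} where

  AllPairs-++⁻ : ∀ xs {ys} → AllPairs R (xs ++ ys) →
                 AllPairs R xs × AllPairs R ys × All (λ x → All (R x) ys) xs
  AllPairs-++⁻ []       rys         = [] , rys , []
  AllPairs-++⁻ (x ∷ xs) (rx ∷ rxsys) with AllPairs-++⁻ xs rxsys
  ... | rxs , rys , rxsys′ = All.++⁻ˡ xs rx ∷ rxs , rys , All.++⁻ʳ xs rx ∷ rxsys′

  AllPairs-++-++⇔ : ∀ xs ys {zs} → AllPairs R (xs ++ ys ++ zs) ⇔
                    (AllPairs R (xs ++ ys) × AllPairs R (ys ++ zs) × AllPairs R (xs ++ zs))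
  AllPairs-++-++⇔ xs ys {zs} = mk⇔ split join
    where
    split : AllPairs R (xs ++ ys ++ zs) →
            AllPairs R (xs ++ ys) × AllPairs R (ys ++ zs) × AllPairs R (xs ++ zs)
    split rxyz with AllPairs-++⁻ xs rxyz
    ... | rxs , ryzs , rxsyzs with AllPairs-++⁻ ys ryzs | All.unzipWith (All.++⁻ ys) rxsyzs
    ...   | rys , rzs , _ | rxsys , rxszs =
      AllPairs.++⁺ rxs rys rxsys , ryzs , AllPairs.++⁺ rxs rzs rxszs
    join : AllPairs R (xs ++ ys) × AllPairs R (ys ++ zs) × AllPairs R (xs ++ zs) →
           AllPairs R (xs ++ ys ++ zs)
    join (rxys , ryzs , rxzs) with AllPairs-++⁻ xs rxys | AllPairs-++⁻ xs rxzs
    ... | rxs , _ , rxsys | _ , _ , rxszs =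
      AllPairs.++⁺ rxs ryzs (All.zipWith (uncurry All.++⁺) (rxsys , rxszs))

  AllPairs-drop-++ : ∀ xs {ys} → i ≤ j → AllPairs R (drop i xs ++ ys) → AllPairs R (drop j xs ++ ys)
  AllPairs-drop-++ {i = i} {j} xs {ys} i≤j r =
    proj₁ (proj₂ (to (AllPairs-++-++⇔ (take (j ∸ i) (drop i xs)) (drop j xs)) (subst (AllPairs R) split r)))
    where
    split : drop i xs ++ ys ≡ take (j ∸ i) (drop i xs) ++ drop j xs ++ ys
    split = trans (cong (_++ ys) (sym (take-drop++drop xs i≤j))) (++-assoc (take (j ∸ i) (drop i xs)) (drop j xs) ys)

  AllPairs-++-take : ∀ xs ys → i ≤ j → AllPairs R (xs ++ take j ys) → AllPairs R (xs ++ take i ys)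
  AllPairs-++-take {i = i} {j} xs ys i≤j r =
    proj₁ (to (AllPairs-++-++⇔ xs (take i ys)) (subst (AllPairs R) split r))
    where
    split : xs ++ take j ys ≡ xs ++ take i ys ++ drop i (take j ys)
    split = cong (xs ++_) (sym (take++drop-take ys i≤j))

∈-range1⁻ : j ∈ range1 k → ∃ λ i → i < k × j ≡ suc i
∈-range1⁻ j∈ with ∈-map⁻ suc j∈
... | i , i∈ , refl = i , ∈-upTo⁻ i∈ , refl

∈-range1⁺ : i < k → suc i ∈ range1 k
∈-range1⁺ i<k = ∈-map⁺ suc (∈-upTo⁺ i<k)

∈⇒≤foldr-⊔ : ∀ {x xs} e → x ∈ xs → x ≤ foldr _⊔_ e xs
∈⇒≤foldr-⊔ e (here refl) = m≤m⊔n _ _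
∈⇒≤foldr-⊔ e (there x∈) = ≤-trans (∈⇒≤foldr-⊔ e x∈) (m≤n⊔m _ _)

∈⇒foldr-⊓≤ : ∀ {x xs} e → x ∈ xs → foldr _⊓_ e xs ≤ x
∈⇒foldr-⊓≤ e (here refl) = m⊓n≤m _ _
∈⇒foldr-⊓≤ e (there x∈) = ≤-trans (m⊓n≤n _ _) (∈⇒foldr-⊓≤ e x∈)

module _ {P : Pred ℕ ℓ} (P? : Decidable P) (k : ℕ) where

  -- iL and iR are instances, with the paper's defaults 0 and k + 1 for an empty set.
  largest smallest : ℕ
  largest  = foldr _⊔_ 0       (filter P? (range1 k))
  smallest = foldr _⊓_ (suc k) (filter P? (range1 k))

  private
    ∈-filter-range1⁻ : j ∈ filter P? (range1 k) → ∃ λ i → i < k × j ≡ suc i × P j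
    ∈-filter-range1⁻ j∈ with ∈-filter⁻ P? j∈
    ... | j∈range , Pj with ∈-range1⁻ j∈range
    ...   | i , i<k , j≡ = i , i<k , j≡ , Pj

    suc-∈-filter-range1 : i < k → P (suc i) → suc i ∈ filter P? (range1 k)
    suc-∈-filter-range1 i<k = ∈-filter⁺ P? (∈-range1⁺ i<k)

  largest≤ : largest ≤ k
  largest≤ with foldr-selective ⊔-sel 0 (filter P? (range1 k))
  ... | inj₁ ≡0 = subst (_≤ k) (sym ≡0) z≤n
  ... | inj₂ ∈  with ∈-filter-range1⁻ ∈
  ...   | i , i<k , ≡suc , _ = subst (_≤ k) (sym ≡suc) i<k

  <largest⇔ : (∀ {i j} → i ≤ j → j < k → P (suc j) → P (suc i)) →
              i < k → P (suc i) ⇔ i < largest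
  <largest⇔ {i} downward i<k = mk⇔ (∈⇒≤foldr-⊔ 0 ∘ suc-∈-filter-range1 i<k) below
    where
    below : i < largest → P (suc i)
    below i< with foldr-selective ⊔-sel 0 (filter P? (range1 k))
    ... | inj₁ ≡0 = contradiction (subst (i <_) ≡0 i<) λ ()
    ... | inj₂ ∈  with ∈-filter-range1⁻ ∈
    ...   | j , j<k , ≡suc , Pj =
      downward (≤-pred (subst (i <_) ≡suc i<)) j<k (subst P ≡suc Pj)

  0<smallest : 0 < smallest
  0<smallest with foldr-selective ⊓-sel (suc k) (filter P? (range1 k))
  ... | inj₁ ≡suc = subst (0 <_) (sym ≡suc) z<s
  ... | inj₂ ∈  with ∈-filter-range1⁻ ∈
  ...   | _ , _ , ≡suc , _ = subst (0 <_) (sym ≡suc) z<s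

  smallest≤ : smallest ≤ suc k
  smallest≤ with foldr-selective ⊓-sel (suc k) (filter P? (range1 k))
  ... | inj₁ ≡suc = ≤-reflexive ≡suc
  ... | inj₂ ∈  with ∈-filter-range1⁻ ∈
  ...   | i , i<k , ≡suc , _ = subst (_≤ suc k) (sym ≡suc) (m≤n⇒m≤1+n i<k)

  smallest≤⇔ : (∀ {i j} → i ≤ j → j < k → P (suc i) → P (suc j)) →
               i < k → P (suc i) ⇔ smallest ≤ suc i
  smallest≤⇔ {i} upward i<k = mk⇔ (∈⇒foldr-⊓≤ (suc k) ∘ suc-∈-filter-range1 i<k) above
    where
    above : smallest ≤ suc i → P (suc i)
    above ≤suc with foldr-selective ⊓-sel (suc k) (filter P? (range1 k))
    ... | inj₁ ≡suc = contradiction (subst (_≤ suc i) ≡suc ≤suc) (<⇒≱ (s≤s i<k))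
    ... | inj₂ ∈  with ∈-filter-range1⁻ ∈
    ...   | j , _ , ≡suc , Pj = upward (≤-pred (subst (_≤ suc i) ≡suc ≤suc)) i<k (subst P ≡suc Pj)

module _ {A : Set a} (_≟_ : DecidableEquality A) where

  ED-reflects : ∀ xs → Reflects (Unique xs) (ED _≟_ xs)
  ED-reflects xs with unique? _≟_ xs
  ... | yes u = ofʸ u
  ... | no ¬u = ofⁿ ¬u

  ED≡true⇒Unique : ∀ xs → ED _≟_ xs ≡ true → Unique xs
  ED≡true⇒Unique xs ED≡true = invert (subst (Reflects (Unique xs)) ED≡true (ED-reflects xs))

  ED≡false⇔¬Unique : ∀ xs → ED _≟_ xs ≡ false ⇔ (¬ Unique xs)
  ED≡false⇔¬Unique xs = mk⇔
    (λ ED≡false → invert (subst (Reflects (Unique xs)) ED≡false (ED-reflects xs)))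
    (det (ED-reflects xs) ∘ ofⁿ)

module _ {A : Set a} (_≟_ : DecidableEquality A) (P M Q : List A) where

  private
    p n : ℕ
    p = length P
    n = length P + length M

    x y : List A
    x = P ++ M ++ Q
    y = take p x ++ drop n x

    left? : Decidable (λ j → ED _≟_ (sub j n x) ≡ false)
    left? j = ED _≟_ (sub j n x) ≟B false

    right? : Decidable (λ j → ED _≟_ (sub (suc p) (n + j) x) ≡ false)
    right? j = ED _≟_ (sub (suc p) (n + j) x) ≟B false

    -- definitionally iL _≟_ n (suc p) x and iR _≟_ n (suc p) x
    iₗ iᵣ : ℕ
    iₗ = largest left? p
    iᵣ = smallest right? p

  window-≡ : i ≤ p → take n (drop i x) ≡ drop i P ++ M ++ take i Q
  window-≡ {i} i≤p = begin
    take n (drop i x)                               ≡⟨ cong (λ t → take t (drop i x)) n≡ ⟩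
    take (p ∸ i + (length M + i)) (drop i x)        ≡⟨ take-drop-++ P (length M + i) (M ++ Q) i≤p ⟩
    drop i P ++ take (length M + i) (M ++ Q)        ≡⟨ cong (drop i P ++_) (take-length+-++ M i Q) ⟩
    drop i P ++ M ++ take i Q                       ∎
    where
    n≡ : n ≡ p ∸ i + (length M + i)
    n≡ = trans (cong (_+ length M) (sym (m∸n+n≡m i≤p)))
               (trans (+-assoc (p ∸ i) i (length M)) (cong (p ∸ i +_) (+-comm i (length M))))

  y-window-≡ : i ≤ p → take p (drop i y) ≡ drop i P ++ take i Q
  y-window-≡ {i} i≤p = begin
    take p (drop i y)                    ≡⟨ cong (λ t → take p (drop i t)) y≡P++Q ⟩
    take p (drop i (P ++ Q))             ≡⟨ cong (λ t → take t (drop i (P ++ Q))) (sym (m∸n+n≡m i≤p)) ⟩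
    take (p ∸ i + i) (drop i (P ++ Q))   ≡⟨ take-drop-++ P i Q i≤p ⟩
    drop i P ++ take i Q                 ∎
    where
    y≡P++Q : y ≡ P ++ Q
    y≡P++Q = cong₂ _++_ (take-length-++ P (M ++ Q)) (begin
      drop (p + length M) x       ≡⟨ sym (drop-drop p (length M) x) ⟩
      drop (length M) (drop p x)  ≡⟨ cong (drop (length M)) (drop-length-++ P (M ++ Q)) ⟩
      drop (length M) (M ++ Q)    ≡⟨ drop-length-++ M Q ⟩
      Q                           ∎)

  left-≡ : i ≤ p → sub (suc i) n x ≡ drop i P ++ M
  left-≡ {i} i≤p = begin
    take (n + 1 ∸ suc i) (drop i x)           ≡⟨ cong (λ t → take t (drop i x)) length≡ ⟩
    take (p ∸ i + length M) (drop i x)        ≡⟨ take-drop-++ P (length M) (M ++ Q) i≤p ⟩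
    drop i P ++ take (length M) (M ++ Q)      ≡⟨ cong (drop i P ++_) (take-length-++ M Q) ⟩
    drop i P ++ M                             ∎
    where
    length≡ : n + 1 ∸ suc i ≡ p ∸ i + length M
    length≡ = trans (cong (_∸ suc i) (+-comm n 1)) (+-∸-comm (length M) i≤p)

  middle-≡ : sub (suc p) n x ≡ M
  middle-≡ = trans (left-≡ ≤-refl) (cong (_++ M) (drop-all p P ≤-refl))

  right-≡ : ∀ j → sub (suc p) (n + j) x ≡ M ++ take j Q
  right-≡ j = begin
    take (n + j + 1 ∸ suc p) (drop p x)     ≡⟨ cong₂ take length≡ (drop-length-++ P (M ++ Q)) ⟩
    take (length M + j) (M ++ Q)            ≡⟨ take-length+-++ M j Q ⟩
    M ++ take j Q                           ∎
    where
    length≡ : n + j + 1 ∸ suc p ≡ length M + j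
    length≡ = trans (cong (_∸ suc p) (+-comm (n + j) 1))
                    (trans (cong (_∸ p) (+-assoc p (length M) j)) (m+n∸m≡n p (length M + j)))

  private
    left-violation⇔ : i ≤ p → ED _≟_ (sub (suc i) n x) ≡ false ⇔ (¬ Unique (drop i P ++ M))
    left-violation⇔ {i} i≤p =
      subst (λ w → ED _≟_ (sub (suc i) n x) ≡ false ⇔ (¬ Unique w)) (left-≡ i≤p) (ED≡false⇔¬Unique _≟_ _)

    right-violation⇔ : ∀ j → ED _≟_ (sub (suc p) (n + j) x) ≡ false ⇔ (¬ Unique (M ++ take j Q))
    right-violation⇔ j =
      subst (λ w → ED _≟_ (sub (suc p) (n + j) x) ≡ false ⇔ (¬ Unique w)) (right-≡ j) (ED≡false⇔¬Unique _≟_ _)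

    left-violation⇔<iₗ : i < p → ED _≟_ (sub (suc i) n x) ≡ false ⇔ i < iₗ
    left-violation⇔<iₗ = <largest⇔ left? p λ i≤j j<p violation →
      from (left-violation⇔ (≤-trans i≤j (<⇒≤ j<p)))
        (to (left-violation⇔ (<⇒≤ j<p)) violation ∘ AllPairs-drop-++ P i≤j)

    right-violation⇔iᵣ≤ : i < p → ED _≟_ (sub (suc p) (n + suc i) x) ≡ false ⇔ iᵣ ≤ suc i
    right-violation⇔iᵣ≤ = smallest≤⇔ right? p λ {i} {j} i≤j _ violation →
      from (right-violation⇔ (suc j))
        (to (right-violation⇔ (suc i)) violation ∘ AllPairs-++-take M Q (s≤s i≤j))

  Unique-left⇔ : Unique M → i ≤ p → Unique (drop i P ++ M) ⇔ (¬ i < iₗ)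
  Unique-left⇔ {i} uM i≤p = mk⇔ before-iₗ after-iₗ
    where
    before-iₗ : Unique (drop i P ++ M) → ¬ i < iₗ
    before-iₗ u i<iₗ =
      to (left-violation⇔ i≤p) (from (left-violation⇔<iₗ (<-≤-trans i<iₗ (largest≤ left? p))) i<iₗ) u
    after-iₗ : ¬ i < iₗ → Unique (drop i P ++ M)
    after-iₗ i≮iₗ with m≤n⇒m<n∨m≡n i≤p
    ... | inj₂ refl = subst (λ w → Unique (w ++ M)) (sym (drop-all p P ≤-refl)) uM
    ... | inj₁ i<p  = decidable-stable (unique? _≟_ _) λ ¬u →
      i≮iₗ (to (left-violation⇔<iₗ i<p) (from (left-violation⇔ i≤p) ¬u))

  Unique-right⇔ : Unique M → i ≤ p → Unique (M ++ take i Q) ⇔ i < iᵣ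
  Unique-right⇔ {zero}  uM _      = mk⇔ (λ _ → 0<smallest right? p) (λ _ → subst Unique (sym (++-identityʳ M)) uM)
  Unique-right⇔ {suc i} uM 1+i≤p = mk⇔ before-iᵣ after-iᵣ
    where
    before-iᵣ : Unique (M ++ take (suc i) Q) → suc i < iᵣ
    before-iᵣ u = ≰⇒> λ iᵣ≤ → to (right-violation⇔ (suc i)) (from (right-violation⇔iᵣ≤ 1+i≤p) iᵣ≤) u
    after-iᵣ : suc i < iᵣ → Unique (M ++ take (suc i) Q)
    after-iᵣ i<iᵣ = decidable-stable (unique? _≟_ _) λ ¬u →
      <⇒≱ i<iᵣ (to (right-violation⇔iᵣ≤ 1+i≤p) (from (right-violation⇔ (suc i)) ¬u))

  Unique-window⇔ : Unique M → i ≤ p →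
                   Unique (take n (drop i x)) ⇔ ((¬ i < iₗ × i < iᵣ) × Unique (take p (drop i y)))
  Unique-window⇔ {i} uM i≤p =
    mk⇔ (split ∘ subst Unique (window-≡ i≤p)) (subst Unique (sym (window-≡ i≤p)) ∘ join)
    where
    pairs⇔ : Unique (drop i P ++ M ++ take i Q) ⇔
             (Unique (drop i P ++ M) × Unique (M ++ take i Q) × Unique (drop i P ++ take i Q))
    pairs⇔ = AllPairs-++-++⇔ (drop i P) M
    split : Unique (drop i P ++ M ++ take i Q) → (¬ i < iₗ × i < iᵣ) × Unique (take p (drop i y))
    split u with to pairs⇔ u
    ... | uₗ , uᵣ , uₒ = (to (Unique-left⇔ uM i≤p) uₗ , to (Unique-right⇔ uM i≤p) uᵣ)
                       , subst Unique (sym (y-window-≡ i≤p)) uₒ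
    join : (¬ i < iₗ × i < iᵣ) × Unique (take p (drop i y)) → Unique (drop i P ++ M ++ take i Q)
    join ((i≮iₗ , i<iᵣ) , u) = from pairs⇔
      (from (Unique-left⇔ uM i≤p) i≮iₗ , from (Unique-right⇔ uM i≤p) i<iᵣ , subst Unique (y-window-≡ i≤p) u)

  ED-window : Unique M → i ≤ p →
              ED _≟_ (take n (drop i x)) ≡ (not (i <ᵇ iₗ) ∧ (i <ᵇ iᵣ)) ∧ ED _≟_ (take p (drop i y))
  ED-window {i} uM i≤p =
    det (Reflects-resp-⇔ (Unique-window⇔ uM i≤p) (ED-reflects _≟_ _))
        ((¬-reflects (<ᵇ-reflects-< i iₗ) ×-reflects <ᵇ-reflects-< i iᵣ) ×-reflects ED-reflects _≟_ _)

  slide-repeated-middle : ED _≟_ (sub (suc p) n x) ≡ false → slide (ED _≟_) n (suc p) x ≡ replicate (suc p) false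
  slide-repeated-middle ED≡false = begin
    slide (ED _≟_) n (suc p) x                             ≡⟨ map-upTo _ (suc p) ⟩
    applyUpTo (λ i → ED _≟_ (take n (drop i x))) (suc p)   ≡⟨ applyUpTo-cong (suc p) (ED-window≡false ∘ ≤-pred) ⟩
    applyUpTo (λ _ → false) (suc p)                        ≡⟨ applyUpTo-const false (suc p) ⟩
    replicate (suc p) false                                ∎
    where
    ¬uM : ¬ Unique M
    ¬uM = to (ED≡false⇔¬Unique _≟_ M) (subst (λ w → ED _≟_ w ≡ false) middle-≡ ED≡false)
    ED-window≡false : i ≤ p → ED _≟_ (take n (drop i x)) ≡ false
    ED-window≡false {i} i≤p = from (ED≡false⇔¬Unique _≟_ _) λ u →
      ¬uM (proj₁ (proj₂ (AllPairs-++⁻ (drop i P)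
        (proj₁ (to (AllPairs-++-++⇔ (drop i P) M) (subst Unique (window-≡ i≤p) u))))))

  slide-distinct-middle : ED _≟_ (sub (suc p) n x) ≡ true →
    slide (ED _≟_) n (suc p) x
      ≡ zipWith _∧_
          (zipWith _∧_ (replicate iₗ false ++ replicate (suc p ∸ iₗ) true)
                       (replicate iᵣ true ++ replicate (suc p ∸ iᵣ) false))
          (slide (ED _≟_) p (suc p) y)
  slide-distinct-middle ED≡true = begin
    slide (ED _≟_) n (suc p) x
      ≡⟨ map-upTo _ (suc p) ⟩
    applyUpTo (λ i → ED _≟_ (take n (drop i x))) (suc p)
      ≡⟨ applyUpTo-cong (suc p) (ED-window uM ∘ ≤-pred) ⟩
    applyUpTo (λ i → (not (i <ᵇ iₗ) ∧ (i <ᵇ iᵣ)) ∧ ED _≟_ (take p (drop i y))) (suc p)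
      ≡⟨ sym (zipWith-applyUpTo _∧_ (λ i → not (i <ᵇ iₗ) ∧ (i <ᵇ iᵣ)) (λ i → ED _≟_ (take p (drop i y))) (suc p)) ⟩
    zipWith _∧_ (applyUpTo (λ i → not (i <ᵇ iₗ) ∧ (i <ᵇ iᵣ)) (suc p))
                (applyUpTo (λ i → ED _≟_ (take p (drop i y))) (suc p))
      ≡⟨ cong₂ (zipWith _∧_) (sym (zipWith-applyUpTo _∧_ (λ i → not (i <ᵇ iₗ)) (_<ᵇ iᵣ) (suc p))) (sym (map-upTo _ (suc p))) ⟩
    zipWith _∧_ (zipWith _∧_ (applyUpTo (λ i → not (i <ᵇ iₗ)) (suc p)) (applyUpTo (_<ᵇ iᵣ) (suc p)))
                (slide (ED _≟_) p (suc p) y)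
      ≡⟨ cong (λ bits → zipWith _∧_ bits (slide (ED _≟_) p (suc p) y))
              (cong₂ (zipWith _∧_) (applyUpTo-<ᵇ not iₗ≤m) (applyUpTo-<ᵇ id iᵣ≤m)) ⟩
    zipWith _∧_
      (zipWith _∧_ (replicate iₗ false ++ replicate (suc p ∸ iₗ) true)
                   (replicate iᵣ true ++ replicate (suc p ∸ iᵣ) false))
      (slide (ED _≟_) p (suc p) y)                          ∎
    where
    uM : Unique M
    uM = ED≡true⇒Unique _≟_ M (subst (λ w → ED _≟_ w ≡ true) middle-≡ ED≡true)
    iₗ≤m : iₗ ≤ suc p
    iₗ≤m = m≤n⇒m≤1+n (largest≤ left? p)
    iᵣ≤m : iᵣ ≤ suc p
    iᵣ≤m = smallest≤ right? p

lemma3p3 : ∀ {a} {A : Set a} (_≟_ : DecidableEquality A) (n m : ℕ) → 0 < m → m < n →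
    (x : List A) → length x ≡ n + m ∸ 1 →
    (ED _≟_ (sub m n x) ≡ false → slide (ED _≟_) n m x ≡ replicate m false)
    × (ED _≟_ (sub m n x) ≡ true →
        slide (ED _≟_) n m x
          ≡ zipWith _∧_
              (zipWith _∧_
                (replicate (iL _≟_ n m x) false ++ replicate (m ∸ iL _≟_ n m x) true)
                (replicate (iR _≟_ n m x) true ++ replicate (m ∸ iR _≟_ n m x) false))
              (slide (ED _≟_) (m ∸ 1) m (take (m ∸ 1) x ++ drop n x)))
lemma3p3 _≟_ n (suc p) _ m<n x ∣x∣≡
  with P , M , Q , refl , refl , refl ← three-way-split x (≤-trans (n≤1+n p) (<⇒≤ m<n))
         (≤-trans (m≤m+n n p) (≤-reflexive (sym (trans ∣x∣≡ (cong (_∸ 1) (+-suc n p))))))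
  = slide-repeated-middle _≟_ P M Q , slide-distinct-middle _≟_ P M Q
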